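{- Let $(k_n)_{n\ge1}$ be a sequence of integers tending to $+\infty$, and assume $k_n\le M_n$ for all large enough $n$. Then, as $n\to+\infty$, \[\frac{B_{n,k_{n+1}}}{B_{n+1,k_{n+1}}}=\Theta\Big(\frac1{k_{n+1}}\Big).\]
   Context: ${n\brace p}$ is the Stirling number of the second kind and $B_{n,k}=\sum_{p=1}^{k}{n\brace p}2^{ -p}$. For each $n\ge1$, $M_n$ is the integer such that the sequence $a_p^{(n)}=\frac{p^n}{p!}2^{ -p}$, $p\in\{1,\dots,n\}$, is strictly increasing on $\{1,\dots,M_n\}$ and strictly decreasing on $\{M_n+1,\dots,n\}$ (it satisfies $M_n\sim n/\ln n$). -}

module Defs where

open import Data.Nat as ℕ using (ℕ; zero; suc; _^_; _!)

open import Data.Integer as ℤ using (ℤ; +_; -[1+_])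
open import Data.Rational using (ℚ; 0ℚ; _/_; _÷_; ≢-nonZero; _+_; _<_)
open import Data.Rational.Properties using (_≟_)
open import Data.Product using (_×_)
open import Relation.Nullary using (yes; no)

S : ℕ → ℕ → ℕ
S zero zero = 1
S zero (suc k) = 0
S (suc n) zero = 0
S (suc n) (suc k) = suc k ℕ.* S n (suc k) ℕ.+ S n k

-- total fraction with natural denominator (denominator 0 ↦ 0; never used with 0 below)
frac : ℤ → ℕ → ℚ
frac m zero = 0ℚ
frac m (suc d) = m / suc d

-- total division on ℚ (division by 0 ↦ 0)
divℚ : ℚ → ℚ → ℚ
divℚ p q with q ≟ 0ℚ
... | yes _ = 0ℚ
... | no q≢0 = _÷_ p q {{≢-nonZero q≢0}}

ℤtoℚ : ℤ → ℚ
ℤtoℚ m = m / 1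

B' : ℕ → ℕ → ℚ
B' n zero = 0ℚ
B' n (suc k) = B' n k + frac (+ S n (suc k)) (2 ^ suc k)

B : ℕ → ℤ → ℚ
B n (+ k) = B' n k
B n -[1+ k ] = 0ℚ

a : ℕ → ℕ → ℚ
a n p = frac (+ (p ^ n)) ((p !) ℕ.* (2 ^ p))

-- IsM n m : m = M_n, i.e. 1 ≤ m ≤ n, (a_p) strictly increasing on {1..m}
-- and strictly decreasing on {m..n} (so a_m is the strict maximum)
IsM : ℕ → ℕ → Set
IsM n m =
  (1 ℕ.≤ m) × (m ℕ.≤ n)
  × (∀ p → 1 ℕ.≤ p → p ℕ.< m → a n p < a n (suc p))
  × (∀ p → m ℕ.≤ p → p ℕ.< n → a n (suc p) < a n p)

-- Write T(n,k) = 2ᵏ B_{n,k}. The recurrence S(n+1,p) = p S(n,p) + S(n,p-1) gives T(n+1,k) ≤ (k+1) T(n,k),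
-- hence the lower bound. For the upper bound put h = ⌊k/2⌋ - 1. The hypothesis k ≤ M_{n+1} says that
-- (1 + 1/q)ⁿ > 2q for q < k; at q = 2p+1 this yields 4(p+1) pⁿ ≤ (p+1)ⁿ for p ≤ h, and together with
-- p! S(n,p) ≤ pⁿ ≤ p! S(n,p) + p (p-1)ⁿ (both read off pⁿ = Σⱼ p(p-1)⋯(p-j+1) S(n,j)) it gives T(n,h) ≤ S(n,h+1):
-- the terms of B_{n,k} with p ≤ h are dominated by the single term p = h+1. Hence indices p > h carry a fixed
-- fraction of T(n,k), that is (h+1) T(n,k) ≤ 3 Σ_p p S(n,p) 2^{k-p} ≤ 3 T(n+1,k), and k ≤ 3(h+1).

module Submission where

module StirlingSums where
  open import Data.Nat
  open import Data.Nat.Properties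
  open import Data.Nat.Tactic.RingSolver using (solve-∀)
  open import Data.Product using (_×_; _,_)
  open import Data.Sum using (inj₁; inj₂)
  open import Relation.Binary.PropositionalEquality
  open import Relation.Nullary using (yes; no)
  open import Defs using (S)

  ∑ : ℕ → (ℕ → ℕ) → ℕ
  ∑ zero    f = 0
  ∑ (suc N) f = ∑ N f + f N

  syntax ∑ N (λ j → e) = ∑[ j < N ] e

  ∑-cong : ∀ N {f g} → (∀ j → f j ≡ g j) → ∑ N f ≡ ∑ N g
  ∑-cong zero    f≗g = refl
  ∑-cong (suc N) f≗g = cong₂ _+_ (∑-cong N f≗g) (f≗g N)

  ∑-distrib-+ : ∀ N f g → ∑[ j < N ] (f j + g j) ≡ ∑ N f + ∑ N g
  ∑-distrib-+ zero    f g = refl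
  ∑-distrib-+ (suc N) f g = trans (cong (_+ (f N + g N)) (∑-distrib-+ N f g))
                                  (interchange (∑ N f) (∑ N g) (f N) (g N))
    where
    interchange : ∀ a b c d → (a + b) + (c + d) ≡ (a + c) + (b + d)
    interchange = solve-∀

  ∑-distribˡ-* : ∀ N c f → ∑[ j < N ] (c * f j) ≡ c * ∑ N f
  ∑-distribˡ-* zero    c f = sym (*-zeroʳ c)
  ∑-distribˡ-* (suc N) c f = trans (cong (_+ c * f N) (∑-distribˡ-* N c f))
                                   (sym (*-distribˡ-+ c (∑ N f) (f N)))

  ∑-suc : ∀ N f → ∑ (suc N) f ≡ f 0 + ∑[ j < N ] f (suc j)
  ∑-suc zero    f = +-comm 0 (f 0)
  ∑-suc (suc N) f = trans (cong (_+ f (suc N)) (∑-suc N f)) (+-assoc (f 0) _ _)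

  ∑-trailing : ∀ f {M} N → M ≤ N → (∀ j → M ≤ j → f j ≡ 0) → ∑ N f ≡ ∑ M f
  ∑-trailing f zero    z≤n   vanish = refl
  ∑-trailing f {M} (suc N) M≤1+N vanish with m≤n⇒m<n∨m≡n M≤1+N
  ... | inj₂ refl = refl
  ... | inj₁ M<1+N = begin
    ∑ N f + f N ≡⟨ cong (∑ N f +_) (vanish N M≤N) ⟩
    ∑ N f + 0   ≡⟨ +-identityʳ (∑ N f) ⟩
    ∑ N f       ≡⟨ ∑-trailing f N M≤N vanish ⟩
    ∑ M f       ∎
    where
    open ≡-Reasoning
    M≤N : M ≤ N
    M≤N = s≤s⁻¹ M<1+N

  ∑-mono-≤ : ∀ N {f g} → (∀ j → j < N → f j ≤ g j) → ∑ N f ≤ ∑ N g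
  ∑-mono-≤ zero    f≤g = z≤n
  ∑-mono-≤ (suc N) f≤g = +-mono-≤ (∑-mono-≤ N (λ j j<N → f≤g j (m<n⇒m<1+n j<N))) (f≤g N ≤-refl)

  term≤∑ : ∀ f {i} N → i < N → f i ≤ ∑ N f
  term≤∑ f (suc N) i<1+N with m≤n⇒m<n∨m≡n (s≤s⁻¹ i<1+N)
  ... | inj₁ i<N  = ≤-trans (term≤∑ f N i<N) (m≤m+n (∑ N f) (f N))
  ... | inj₂ refl = m≤n+m (f N) (∑ N f)

  infixl 8 _↓_

  _↓_ : ℕ → ℕ → ℕ
  p     ↓ zero  = 1
  zero  ↓ suc j = 0
  suc p ↓ suc j = suc p * (p ↓ j)

  -- p ↓ (j + 1) = (p − j) (p ↓ j), with the truncated subtraction moved to the other side.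
  ↓-suc : ∀ p j → p * (p ↓ j) ≡ p ↓ suc j + j * (p ↓ j)
  ↓-suc zero    zero    = refl
  ↓-suc zero    (suc j) = sym (*-zeroʳ (suc j))
  ↓-suc (suc p) zero    = sym (+-identityʳ (suc p * 1))
  ↓-suc (suc p) (suc j) = trans (cong (λ x → suc p * (p ↓ j + x)) (↓-suc p j))
                                (regroup p (p ↓ j) (p ↓ suc j) j)
    where
    regroup : ∀ p F G j → suc p * (F + (G + j * F)) ≡ suc p * G + suc j * (suc p * F)
    regroup = solve-∀

  ↓-self : ∀ p → p ↓ p ≡ p !
  ↓-self zero    = refl
  ↓-self (suc p) = cong (suc p *_) (↓-self p)

  ↓-vanish : ∀ {p j} → p < j → p ↓ j ≡ 0
  ↓-vanish {zero}  {suc j} _         = refl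
  ↓-vanish {suc p} {suc j} (s≤s p<j) = trans (cong (suc p *_) (↓-vanish p<j)) (*-zeroʳ (suc p))

  ↓-mono : ∀ q {i} → i < q → q ↓ i ≤ q ↓ suc i
  ↓-mono (suc q) {zero}  _         = m≤n*m 1 (suc q)
  ↓-mono (suc q) {suc i} (s≤s i<q) = *-monoʳ-≤ (suc q) (↓-mono q i<q)

  ↓-suc-≤ : ∀ q {j} → j ≤ q → suc q ↓ j ≤ suc q * (q ↓ j)
  ↓-suc-≤ q {zero}  _    = m≤n*m 1 (suc q)
  ↓-suc-≤ q {suc j} j<q = *-monoʳ-≤ (suc q) (↓-mono q j<q)

  S-vanish : ∀ {n j} → n < j → S n j ≡ 0
  S-vanish {zero}  {suc j} _         = refl
  S-vanish {suc n} {suc j} (s≤s n<j) rewrite S-vanish (m<n⇒m<1+n n<j) | S-vanish n<j =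
    trans (+-identityʳ (suc j * 0)) (*-zeroʳ (suc j))

  S-suc-1 : ∀ n → S (suc n) 1 ≡ 1
  S-suc-1 zero    = refl
  S-suc-1 (suc n) rewrite S-suc-1 n = refl

  *-zeroʳ-by : ∀ m {n} → n ≡ 0 → m * n ≡ 0
  *-zeroʳ-by m refl = *-zeroʳ m

  ^≡∑↓S : ∀ p n N → n < N → p ^ n ≡ ∑[ j < N ] (p ↓ j * S n j)
  ^≡∑↓S p zero    N       0<N       = sym (∑-trailing _ N 0<N (λ j 1≤j → *-zeroʳ-by (p ↓ j) (S-vanish 1≤j)))
  ^≡∑↓S p (suc n) (suc N) (s≤s n<N) = begin
    p * p ^ n
      ≡⟨ cong (p *_) (^≡∑↓S p n (suc N) (m<n⇒m<1+n n<N)) ⟩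
    p * ∑[ j < suc N ] (p ↓ j * S n j)
      ≡⟨ ∑-distribˡ-* (suc N) p _ ⟨
    ∑[ j < suc N ] (p * (p ↓ j * S n j))
      ≡⟨ ∑-cong (suc N) split ⟩
    ∑[ j < suc N ] (shifted j + j * (p ↓ j * S n j))
      ≡⟨ ∑-distrib-+ (suc N) shifted _ ⟩
    ∑ (suc N) shifted + ∑[ j < suc N ] (j * (p ↓ j * S n j))
      ≡⟨ cong₂ _+_ (∑-trailing shifted (suc N) (n≤1+n N) shifted-vanish) (∑-suc N _) ⟩
    ∑ N shifted + ∑ N weighted
      ≡⟨ +-comm (∑ N shifted) (∑ N weighted) ⟩
    ∑ N weighted + ∑ N shifted
      ≡⟨ ∑-distrib-+ N weighted shifted ⟨
    ∑[ j < N ] (weighted j + shifted j)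
      ≡⟨ ∑-cong N (λ j → regroup (p ↓ suc j) j (S n (suc j)) (S n j)) ⟩
    ∑[ j < N ] (p ↓ suc j * S (suc n) (suc j))
      ≡⟨ ∑-suc N _ ⟨
    ∑[ j < suc N ] (p ↓ j * S (suc n) j) ∎
    where
    open ≡-Reasoning
    shifted weighted : ℕ → ℕ
    shifted  j = p ↓ suc j * S n j
    weighted j = suc j * (p ↓ suc j * S n (suc j))
    split : ∀ j → p * (p ↓ j * S n j) ≡ shifted j + j * (p ↓ j * S n j)
    split j = begin
      p * (p ↓ j * S n j)                 ≡⟨ *-assoc p (p ↓ j) (S n j) ⟨
      p * p ↓ j * S n j                   ≡⟨ cong (_* S n j) (↓-suc p j) ⟩
      (p ↓ suc j + j * p ↓ j) * S n j     ≡⟨ *-distribʳ-+ (S n j) (p ↓ suc j) (j * p ↓ j) ⟩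
      shifted j + j * p ↓ j * S n j       ≡⟨ cong (shifted j +_) (*-assoc j (p ↓ j) (S n j)) ⟩
      shifted j + j * (p ↓ j * S n j)     ∎
    shifted-vanish : ∀ j → N ≤ j → shifted j ≡ 0
    shifted-vanish j N≤j = *-zeroʳ-by (p ↓ suc j) (S-vanish (<-≤-trans n<N N≤j))
    regroup : ∀ F j s t → suc j * (F * s) + F * t ≡ F * (suc j * s + t)
    regroup = solve-∀

  ^≡∑↓S-≤ : ∀ {p n} → p ≤ n → p ^ n ≡ ∑[ j < suc p ] (p ↓ j * S n j)
  ^≡∑↓S-≤ {p} {n} p≤n = trans (^≡∑↓S p n (suc n) ≤-refl)
    (∑-trailing _ (suc n) (s≤s p≤n) (λ j p<j → cong (_* S n j) (↓-vanish p<j)))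

  !*S≤^ : ∀ p n → p ! * S n p ≤ p ^ n
  !*S≤^ p n with p ≤? n
  ... | yes p≤n = begin
    p ! * S n p                    ≡⟨ cong (_* S n p) (↓-self p) ⟨
    p ↓ p * S n p                  ≤⟨ term≤∑ (λ j → p ↓ j * S n j) (suc p) ≤-refl ⟩
    ∑[ j < suc p ] (p ↓ j * S n j) ≡⟨ ^≡∑↓S-≤ p≤n ⟨
    p ^ n                          ∎
    where open ≤-Reasoning
  ... | no p≰n = ≤-trans (≤-reflexive (*-zeroʳ-by (p !) (S-vanish (≰⇒> p≰n)))) z≤n

  ^≤!*S+ : ∀ q n → suc q ≤ n → suc q ^ n ≤ suc q ! * S n (suc q) + suc q * q ^ n
  ^≤!*S+ q n 1+q≤n = begin
    p ^ n                    ≡⟨ ^≡∑↓S-≤ 1+q≤n ⟩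
    ∑ p f + f p              ≡⟨ +-comm (∑ p f) (f p) ⟩
    f p + ∑ p f              ≤⟨ +-monoˡ-≤ (∑ p f) (≤-reflexive (cong (_* S n p) (↓-self p))) ⟩
    p ! * S n p + ∑ p f      ≤⟨ +-monoʳ-≤ (p ! * S n p) (∑-mono-≤ p f≤p*g) ⟩
    p ! * S n p + ∑[ j < p ] (p * g j) ≡⟨ cong (p ! * S n p +_) (∑-distribˡ-* p p g) ⟩
    p ! * S n p + p * ∑ p g  ≡⟨ cong (λ x → p ! * S n p + p * x) (^≡∑↓S-≤ (<⇒≤ 1+q≤n)) ⟨
    p ! * S n p + p * q ^ n  ∎
    where
    open ≤-Reasoning
    p = suc q
    f g : ℕ → ℕ
    f j = p ↓ j * S n j
    g j = q ↓ j * S n j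
    f≤p*g : ∀ j → j < p → f j ≤ p * g j
    f≤p*g j j<p = ≤-trans (*-monoˡ-≤ (S n j) (↓-suc-≤ q (s≤s⁻¹ j<p))) (≤-reflexive (*-assoc p (q ↓ j) (S n j)))

  ^-distribʳ-* : ∀ m n o → (m * n) ^ o ≡ m ^ o * n ^ o
  ^-distribʳ-* m n zero    = refl
  ^-distribʳ-* m n (suc o) = trans (cong (m * n *_) (^-distribʳ-* m n o)) (interchange m n (m ^ o) (n ^ o))
    where
    interchange : ∀ a b c d → a * b * (c * d) ≡ a * c * (b * d)
    interchange = solve-∀

  -- Ascent n q is the inequality a_q < a_{q+1} for the sequence a = a^{(n+1)}, after clearing denominators.
  Ascent : ℕ → ℕ → Set
  Ascent n q = 2 * q * q ^ n < suc q ^ n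

  Ascending : ℕ → ℕ → Set
  Ascending n m = ∀ q → 1 ≤ q → q < m → Ascent n q

  -- from q (q + 2) ≤ (q + 1)²
  ascent-pred : ∀ n q → Ascent n (suc q) → 2 * suc q * q ^ n ≤ suc q ^ n
  ascent-pred n q asc = *-cancelʳ-≤ _ _ (suc q ^ n) {{m^n≢0 (suc q) n}} (begin
    2 * suc q * q ^ n * suc q ^ n       ≡⟨ swap (2 * suc q) (q ^ n) (suc q ^ n) ⟩
    q ^ n * (2 * suc q * suc q ^ n)     ≤⟨ *-monoʳ-≤ (q ^ n) (<⇒≤ asc) ⟩
    q ^ n * suc (suc q) ^ n             ≡⟨ ^-distribʳ-* q (suc (suc q)) n ⟨
    (q * suc (suc q)) ^ n               ≤⟨ ^-monoˡ-≤ n (subst (q * suc (suc q) ≤_) (square q) (m≤m+n _ 1)) ⟩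
    (suc q * suc q) ^ n                 ≡⟨ ^-distribʳ-* (suc q) (suc q) n ⟩
    suc q ^ n * suc q ^ n               ∎)
    where
    open ≤-Reasoning
    swap : ∀ a b c → a * b * c ≡ b * (a * c)
    swap = solve-∀
    square : ∀ q → q * suc (suc q) + 1 ≡ suc q * suc q
    square = solve-∀

  -- from p (2p + 2)² ≤ (p + 1)(2p + 1)²
  ascent-halve : ∀ n p → Ascent n (suc (2 * p)) → 4 * suc p * p ^ n ≤ suc p ^ n
  ascent-halve n p asc = ≤-trans 4[p+1]≤4a² (*-cancelʳ-≤ _ _ ((a * a) ^ n) {{m^n≢0 (a * a) n}} (begin
    4 * (a * a) * p ^ n * (a * a) ^ n         ≡⟨ cong (4 * (a * a) * p ^ n *_) (^-distribʳ-* a a n) ⟩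
    4 * (a * a) * p ^ n * (X * X)             ≡⟨ square-out a (p ^ n) X ⟩
    p ^ n * ((2 * a * X) * (2 * a * X))       ≤⟨ *-monoʳ-≤ (p ^ n) (*-mono-≤ (<⇒≤ asc) (<⇒≤ asc)) ⟩
    p ^ n * (suc a ^ n * suc a ^ n)           ≡⟨ cong (p ^ n *_) (^-distribʳ-* (suc a) (suc a) n) ⟨
    p ^ n * (suc a * suc a) ^ n               ≡⟨ ^-distribʳ-* p (suc a * suc a) n ⟨
    (p * (suc a * suc a)) ^ n                 ≤⟨ ^-monoˡ-≤ n (subst (p * (suc a * suc a) ≤_) (cubic p) (m≤m+n _ (suc p))) ⟩
    (suc p * (a * a)) ^ n                     ≡⟨ ^-distribʳ-* (suc p) (a * a) n ⟩
    suc p ^ n * (a * a) ^ n                   ∎))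
    where
    open ≤-Reasoning
    a = suc (2 * p)
    X = a ^ n
    4[p+1]≤4a² : 4 * suc p * p ^ n ≤ 4 * (a * a) * p ^ n
    4[p+1]≤4a² = *-monoˡ-≤ (p ^ n) (*-monoʳ-≤ 4 (≤-trans (s≤s (m≤n*m p 2)) (m≤m*n a a)))
    square-out : ∀ a P X → 4 * (a * a) * P * (X * X) ≡ P * ((2 * a * X) * (2 * a * X))
    square-out = solve-∀
    cubic : ∀ p → p * (suc (suc (2 * p)) * suc (suc (2 * p))) + suc p ≡ suc p * (suc (2 * p) * suc (2 * p))
    cubic = solve-∀

  T W : ℕ → ℕ → ℕ
  T n zero    = 0
  T n (suc k) = 2 * T n k + S n (suc k)
  W n zero    = 0
  W n (suc k) = 2 * W n k + suc k * S n (suc k)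

  S≤T : ∀ n k → S (suc n) k ≤ T (suc n) k
  S≤T n zero    = z≤n
  S≤T n (suc k) = m≤n+m (S (suc n) (suc k)) (2 * T (suc n) k)

  T-pos : ∀ n k → 0 < T (suc n) (suc k)
  T-pos n zero    = ≤-reflexive (sym (S-suc-1 n))
  T-pos n (suc k) = ≤-trans (T-pos n k) (≤-trans (m≤n*m _ 2) (m≤m+n _ _))

  W≤T-suc : ∀ n k → W n k ≤ T (suc n) k
  W≤T-suc n zero    = z≤n
  W≤T-suc n (suc k) = +-mono-≤ (*-monoʳ-≤ 2 (W≤T-suc n k)) (m≤m+n _ _)

  T-suc-≤ : ∀ n k → T (suc (suc n)) k ≤ suc k * T (suc n) k
  T-suc-≤ n zero    = z≤n
  T-suc-≤ n (suc k) = begin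
    2 * T (suc (suc n)) k + (suc k * s + S (suc n) k) ≤⟨ +-mono-≤ (*-monoʳ-≤ 2 (T-suc-≤ n k)) (+-monoʳ-≤ (suc k * s) (S≤T n k)) ⟩
    2 * (suc k * t) + (suc k * s + t)                 ≤⟨ m≤m+n _ (t + s) ⟩
    2 * (suc k * t) + (suc k * s + t) + (t + s)       ≡⟨ regroup k t s ⟩
    suc (suc k) * (2 * t + s)                         ∎
    where
    open ≤-Reasoning
    t = T (suc n) k
    s = S (suc n) (suc k)
    regroup : ∀ k t s → 2 * (suc k * t) + (suc k * s + t) + (t + s) ≡ suc (suc k) * (2 * t + s)
    regroup = solve-∀

  2*!*T≤^ : ∀ {n h} → (∀ p → 1 ≤ p → p ≤ h → 4 * suc p * p ^ n ≤ suc p ^ n) →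
            ∀ q → q ≤ h → 2 * (suc q ! * T n q) ≤ suc q ^ n
  2*!*T≤^ half zero    _     = z≤n
  2*!*T≤^ {n} half (suc q) 1+q≤h = begin
    2 * (suc (suc q) * suc q ! * (2 * T n q + S n (suc q)))
      ≡⟨ expand (suc (suc q)) (suc q !) (T n q) (S n (suc q)) ⟩
    2 * suc (suc q) * (2 * (suc q ! * T n q)) + 2 * suc (suc q) * (suc q ! * S n (suc q))
      ≤⟨ +-mono-≤ (*-monoʳ-≤ (2 * suc (suc q)) (2*!*T≤^ half q (<⇒≤ 1+q≤h)))
                  (*-monoʳ-≤ (2 * suc (suc q)) (!*S≤^ (suc q) n)) ⟩
    2 * suc (suc q) * suc q ^ n + 2 * suc (suc q) * suc q ^ n
      ≡⟨ double (suc (suc q)) (suc q ^ n) ⟩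
    4 * suc (suc q) * suc q ^ n
      ≤⟨ half (suc q) (s≤s z≤n) 1+q≤h ⟩
    suc (suc q) ^ n ∎
    where
    open ≤-Reasoning
    expand : ∀ b F t s → 2 * (b * F * (2 * t + s)) ≡ 2 * b * (2 * (F * t)) + 2 * b * (F * s)
    expand = solve-∀
    double : ∀ b x → 2 * b * x + 2 * b * x ≡ 4 * b * x
    double = solve-∀

  ^≤2*!*S : ∀ {n q} → suc q ≤ n → Ascent n (suc q) → suc q ^ n ≤ 2 * (suc q ! * S n (suc q))
  ^≤2*!*S {n} {q} 1+q≤n asc = +-cancelʳ-≤ P P (2 * F) (begin
    P + P                 ≤⟨ +-mono-≤ (^≤!*S+ q n 1+q≤n) (^≤!*S+ q n 1+q≤n) ⟩
    (F + x) + (F + x)     ≡⟨ double F x ⟩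
    2 * F + 2 * x         ≤⟨ +-monoʳ-≤ (2 * F) (≤-trans (≤-reflexive (sym (*-assoc 2 (suc q) (q ^ n)))) (ascent-pred n q asc)) ⟩
    2 * F + P             ∎)
    where
    open ≤-Reasoning
    P = suc q ^ n
    F = suc q ! * S n (suc q)
    x = suc q * q ^ n
    double : ∀ F x → (F + x) + (F + x) ≡ 2 * F + 2 * x
    double = solve-∀

  T≤S-suc : ∀ {n h} → (∀ p → 1 ≤ p → p ≤ h → 4 * suc p * p ^ n ≤ suc p ^ n) →
            suc h ≤ n → Ascent n (suc h) → T n h ≤ S n (suc h)
  T≤S-suc {h = h} half 1+h≤n asc = *-cancelˡ-≤ (suc h !) {{suc h !≢0}}
    (*-cancelˡ-≤ 2 (≤-trans (2*!*T≤^ half h ≤-refl) (^≤2*!*S 1+h≤n asc)))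

  suc*T≤3*W : ∀ {n h} → T n h ≤ S n (suc h) → ∀ {j} → h < j → suc h * T n j ≤ 3 * W n j
  suc*T≤3*W {n} {h} T≤S {suc j} (s≤s h≤j) with m≤n⇒m<n∨m≡n h≤j
  ... | inj₂ refl = begin
    suc h * (2 * T n h + S n (suc h))       ≤⟨ *-monoʳ-≤ (suc h) (+-monoˡ-≤ (S n (suc h)) (*-monoʳ-≤ 2 T≤S)) ⟩
    suc h * (2 * S n (suc h) + S n (suc h)) ≡⟨ triple h (S n (suc h)) ⟩
    3 * (suc h * S n (suc h))               ≤⟨ *-monoʳ-≤ 3 (m≤n+m _ (2 * W n h)) ⟩
    3 * (2 * W n h + suc h * S n (suc h))   ∎
    where
    open ≤-Reasoning
    triple : ∀ h s → suc h * (2 * s + s) ≡ 3 * (suc h * s)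
    triple = solve-∀
  ... | inj₁ h<j = begin
    suc h * (2 * T n j + s)             ≡⟨ distribute h (T n j) s ⟩
    2 * (suc h * T n j) + suc h * s     ≤⟨ +-mono-≤ (*-monoʳ-≤ 2 (suc*T≤3*W T≤S h<j)) (≤-trans (*-monoˡ-≤ s (s≤s h≤j)) (m≤n*m _ 3)) ⟩
    2 * (3 * W n j) + 3 * (suc j * s)   ≡⟨ regroup (W n j) (suc j * s) ⟩
    3 * (2 * W n j + suc j * s)         ∎
    where
    open ≤-Reasoning
    s = S n (suc j)
    distribute : ∀ h t s → suc h * (2 * t + s) ≡ 2 * (suc h * t) + suc h * s
    distribute = solve-∀
    regroup : ∀ w x → 2 * (3 * w) + 3 * x ≡ 3 * (2 * w + x)
    regroup = solve-∀

  T-ratio-lower : ∀ n K → T (suc (suc n)) (suc K) ≤ T (suc n) (suc K) * (2 * suc K)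
  T-ratio-lower n K = begin
    T (suc (suc n)) (suc K)          ≤⟨ T-suc-≤ n (suc K) ⟩
    suc (suc K) * T (suc n) (suc K)  ≤⟨ *-monoˡ-≤ _ (subst (suc (suc K) ≤_) (sym (*-suc 2 K)) (s≤s (s≤s (m≤n*m K 2)))) ⟩
    2 * suc K * T (suc n) (suc K)    ≡⟨ *-comm (2 * suc K) _ ⟩
    T (suc n) (suc K) * (2 * suc K)  ∎
    where open ≤-Reasoning

  T-ratio-upper-at : ∀ {n m h K} → Ascending n m → m ≤ suc n → suc (suc (2 * h)) ≤ m → h < K →
                     suc h * T n K ≤ 3 * T (suc n) K
  T-ratio-upper-at {n} {m} {h} {K} asc m≤1+n 2h+2≤m h<K = begin
    suc h * T n K    ≤⟨ suc*T≤3*W (T≤S-suc half (s≤s⁻¹ (<-≤-trans 1+h<m m≤1+n)) (asc (suc h) (s≤s z≤n) 1+h<m)) h<K ⟩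
    3 * W n K        ≤⟨ *-monoʳ-≤ 3 (W≤T-suc n K) ⟩
    3 * T (suc n) K  ∎
    where
    open ≤-Reasoning
    1+h<m : suc h < m
    1+h<m = ≤-trans (s≤s (s≤s (m≤n*m h 2))) 2h+2≤m
    half : ∀ p → 1 ≤ p → p ≤ h → 4 * suc p * p ^ n ≤ suc p ^ n
    half p 1≤p p≤h = ascent-halve n p (asc (suc (2 * p)) (s≤s z≤n) (≤-trans (s≤s (s≤s (*-monoʳ-≤ 2 p≤h))) 2h+2≤m))

  ⌊n/2⌋-bounds : ∀ n → 2 * ⌊ n /2⌋ ≤ n × n ≤ suc (2 * ⌊ n /2⌋)
  ⌊n/2⌋-bounds zero          = z≤n , z≤n
  ⌊n/2⌋-bounds (suc zero)    = z≤n , s≤s z≤n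
  ⌊n/2⌋-bounds (suc (suc n)) with ⌊n/2⌋-bounds n
  ... | lower , upper = subst (_≤ suc (suc n)) (sym (*-suc 2 ⌊ n /2⌋)) (s≤s (s≤s lower))
                      , subst (λ x → suc (suc n) ≤ suc x) (sym (*-suc 2 ⌊ n /2⌋)) (s≤s (s≤s upper))

  T-ratio-upper : ∀ {n m K} → Ascending n m → m ≤ suc n → 2 ≤ K → K ≤ m → K * T n K ≤ 9 * T (suc n) K
  T-ratio-upper {n} {m} {suc (suc K)} asc m≤1+n (s≤s (s≤s z≤n)) K+2≤m with ⌊n/2⌋-bounds K
  ... | 2h≤K , K≤2h+1 = begin
    suc (suc K) * T n (suc (suc K))     ≤⟨ *-monoˡ-≤ _ K+2≤3[h+1] ⟩
    3 * suc h * T n (suc (suc K))       ≡⟨ *-assoc 3 (suc h) (T n (suc (suc K))) ⟩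
    3 * (suc h * T n (suc (suc K)))     ≤⟨ *-monoʳ-≤ 3 (T-ratio-upper-at asc m≤1+n (≤-trans (s≤s (s≤s 2h≤K)) K+2≤m) h<K+2) ⟩
    3 * (3 * T (suc n) (suc (suc K)))   ≡⟨ *-assoc 3 3 (T (suc n) (suc (suc K))) ⟨
    9 * T (suc n) (suc (suc K))         ∎
    where
    open ≤-Reasoning
    h = ⌊ K /2⌋
    h<K+2 : h < suc (suc K)
    h<K+2 = s≤s (≤-trans (⌊n/2⌋≤n K) (n≤1+n K))
    K+2≤3[h+1] : suc (suc K) ≤ 3 * suc h
    K+2≤3[h+1] = subst (suc (suc K) ≤_) (sym (*-suc 3 h)) (s≤s (s≤s (≤-trans K≤2h+1 (s≤s (*-monoˡ-≤ h (n≤1+n 2))))))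

module Fractions where
  open import Data.Nat as ℕ using (ℕ; zero; suc; NonZero)
  open import Data.Nat.Properties using (m*n≢0; *-comm)
  open import Data.Nat.Tactic.RingSolver using (solve-∀)
  open import Data.Integer as ℤ using (+_; +[1+_]; -[1+_])
  open import Data.Integer.Properties using (pos-+; pos-*; drop‿+<+; +-injective)
  open import Data.Rational using (ℚ; mkℚ; 0ℚ; _+_; _*_; _≤_; _<_; toℚᵘ)
  open import Data.Rational.Properties
    using (toℚᵘ-fromℚᵘ; toℚᵘ-homo-+; toℚᵘ-homo-*; toℚᵘ-cancel-≤; toℚᵘ-cancel-<; toℚᵘ-mono-<; _≟_)
  open import Data.Rational.Unnormalised as ℚᵘ using (mkℚᵘ; _≃_; *≡*; *≤*; *<*)
  open import Data.Rational.Unnormalised.Properties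
    using (≃-refl; ≃-sym; ≃-trans; ≃-reflexive; +-cong; *-cong; ≤-respˡ-≃; ≤-respʳ-≃; <-respˡ-≃; <-respʳ-≃)
  open import Relation.Binary.PropositionalEquality
  open import Relation.Nullary using (no)
  open import Defs using (frac; divℚ)

  infix 4 _≈_/_

  _≈_/_ : ℚ → ℕ → (D : ℕ) → .{{NonZero D}} → Set
  x ≈ a / D = toℚᵘ x ≃ + a ℚᵘ./ D

  /-≃ : ∀ {a b} D E .{{_ : NonZero D}} .{{_ : NonZero E}} → a ℕ.* E ≡ b ℕ.* D → + a ℚᵘ./ D ≃ + b ℚᵘ./ E
  /-≃ {a} {b} (suc d) (suc e) eq = *≡* (subst₂ _≡_ (pos-* a (suc e)) (pos-* b (suc d)) (cong +_ eq))

  /-≃⁻ : ∀ {a b} D E .{{_ : NonZero D}} .{{_ : NonZero E}} → + a ℚᵘ./ D ≃ + b ℚᵘ./ E → a ℕ.* E ≡ b ℕ.* D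
  /-≃⁻ {a} {b} (suc d) (suc e) (*≡* eq) = +-injective (subst₂ _≡_ (sym (pos-* a (suc e))) (sym (pos-* b (suc d))) eq)

  /-≤ : ∀ {a b} D E .{{_ : NonZero D}} .{{_ : NonZero E}} → a ℕ.* E ℕ.≤ b ℕ.* D → + a ℚᵘ./ D ℚᵘ.≤ + b ℚᵘ./ E
  /-≤ {a} {b} (suc d) (suc e) le = *≤* (subst₂ ℤ._≤_ (pos-* a (suc e)) (pos-* b (suc d)) (ℤ.+≤+ le))

  /-< : ∀ {a b} D E .{{_ : NonZero D}} .{{_ : NonZero E}} → a ℕ.* E ℕ.< b ℕ.* D → + a ℚᵘ./ D ℚᵘ.< + b ℚᵘ./ E
  /-< {a} {b} (suc d) (suc e) lt = *<* (subst₂ ℤ._<_ (pos-* a (suc e)) (pos-* b (suc d)) (ℤ.+<+ lt))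

  /-<⁻ : ∀ {a b} D E .{{_ : NonZero D}} .{{_ : NonZero E}} → + a ℚᵘ./ D ℚᵘ.< + b ℚᵘ./ E → a ℕ.* E ℕ.< b ℕ.* D
  /-<⁻ {a} {b} (suc d) (suc e) (*<* lt) = drop‿+<+ (subst₂ ℤ._<_ (sym (pos-* a (suc e))) (sym (pos-* b (suc d))) lt)

  frac-≈ : ∀ a D .{{_ : NonZero D}} → frac (+ a) D ≈ a / D
  frac-≈ a (suc d) = toℚᵘ-fromℚᵘ (mkℚᵘ (+ a) d)

  ≈-resp : ∀ {x a b D E} .{{_ : NonZero D}} .{{_ : NonZero E}} → x ≈ a / D → a ℕ.* E ≡ b ℕ.* D → x ≈ b / E
  ≈-resp {D = D} {E} x≈ eq = ≃-trans x≈ (/-≃ D E eq)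

  ≈-≤ : ∀ {x y a b D E} .{{_ : NonZero D}} .{{_ : NonZero E}} → x ≈ a / D → y ≈ b / E → a ℕ.* E ℕ.≤ b ℕ.* D → x ≤ y
  ≈-≤ {D = D} {E} x≈ y≈ le = toℚᵘ-cancel-≤ (≤-respˡ-≃ (≃-sym x≈) (≤-respʳ-≃ (≃-sym y≈) (/-≤ D E le)))

  ≈-< : ∀ {x y a b D E} .{{_ : NonZero D}} .{{_ : NonZero E}} → x ≈ a / D → y ≈ b / E → a ℕ.* E ℕ.< b ℕ.* D → x < y
  ≈-< {D = D} {E} x≈ y≈ lt = toℚᵘ-cancel-< (<-respˡ-≃ (≃-sym x≈) (<-respʳ-≃ (≃-sym y≈) (/-< D E lt)))

  ≈-<⁻ : ∀ {x y a b D E} .{{_ : NonZero D}} .{{_ : NonZero E}} → x ≈ a / D → y ≈ b / E → x < y → a ℕ.* E ℕ.< b ℕ.* D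
  ≈-<⁻ {D = D} {E} x≈ y≈ lt = /-<⁻ D E (<-respˡ-≃ x≈ (<-respʳ-≃ y≈ (toℚᵘ-mono-< lt)))

  ≈-+ : ∀ {x y a b D E} .{{_ : NonZero D}} .{{_ : NonZero E}} → x ≈ a / D → y ≈ b / E →
        let instance _ = m*n≢0 D E in x + y ≈ (a ℕ.* E ℕ.+ b ℕ.* D) / (D ℕ.* E)
  ≈-+ {x} {y} {a} {b} {suc d} {suc e} x≈ y≈ = ≃-trans (toℚᵘ-homo-+ x y) (≃-trans (+-cong x≈ y≈)
    (≃-reflexive (cong (ℚᵘ._/ (suc d ℕ.* suc e))
      (trans (cong₂ ℤ._+_ (sym (pos-* a (suc e))) (sym (pos-* b (suc d)))) (sym (pos-+ (a ℕ.* suc e) (b ℕ.* suc d)))))))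

  ≈-* : ∀ {x y a b D E} .{{_ : NonZero D}} .{{_ : NonZero E}} → x ≈ a / D → y ≈ b / E →
        let instance _ = m*n≢0 D E in x * y ≈ (a ℕ.* b) / (D ℕ.* E)
  ≈-* {x} {y} {a} {b} {suc d} {suc e} x≈ y≈ = ≃-trans (toℚᵘ-homo-* x y) (≃-trans (*-cong x≈ y≈)
    (≃-reflexive (cong (ℚᵘ._/ (suc d ℕ.* suc e)) (sym (pos-* a b)))))

  ≈-divℚ : ∀ {x y a b D} .{{_ : NonZero D}} .{{_ : NonZero b}} → x ≈ a / D → y ≈ b / D → divℚ x y ≈ a / b
  ≈-divℚ {y = mkℚ (+ zero)  _ _} {b = suc b} {D = suc d} _ (*≡* ())
  ≈-divℚ {y = mkℚ -[1+ _ ] _ _} {b = suc b} {D = suc d} _ (*≡* ())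
  ≈-divℚ {x} {y@(mkℚ +[1+ n ] d′ _)} {a} {suc b} {suc d} x≈ y≈ with y ≟ 0ℚ
  ... | no _ = ≈-resp (≈-* x≈ ≃-refl) (scale (/-≃⁻ (suc d′) (suc d) y≈))
    where
    scale : suc n ℕ.* suc d ≡ suc b ℕ.* suc d′ → a ℕ.* suc d′ ℕ.* suc b ≡ a ℕ.* (suc d ℕ.* suc n)
    scale nd≡bd′ = begin
      a ℕ.* suc d′ ℕ.* suc b   ≡⟨ rearrange a (suc d′) (suc b) ⟩
      a ℕ.* (suc b ℕ.* suc d′) ≡⟨ cong (a ℕ.*_) nd≡bd′ ⟨
      a ℕ.* (suc n ℕ.* suc d)  ≡⟨ cong (a ℕ.*_) (*-comm (suc n) (suc d)) ⟩
      a ℕ.* (suc d ℕ.* suc n)  ∎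
      where
      open ≡-Reasoning
      rearrange : ∀ a c e → a ℕ.* c ℕ.* e ≡ a ℕ.* (e ℕ.* c)
      rearrange = solve-∀

open import Defs
import Data.Nat as ℕ
open import Data.Nat using (ℕ; zero; suc; _≥_; z≤n; s≤s; _^_; _!; _⊔_; >-nonZero)
open import Data.Nat.Properties using (m^n≢0; m*n≢0; _!≢0; *-cancelʳ-<; *-identityˡ; ≤-trans; m≤n+m; m≤m⊔n; m≤n⊔m)
open import Data.Nat.Tactic.RingSolver using (solve-∀)
open import Data.Integer using (ℤ; +_; +≤+)
open import Data.Rational using (ℚ; 0ℚ; 1ℚ; _<_; _≤_; _*_)
open import Data.Product using (Σ; ∃; _×_; _,_)
open import Data.Rational.Unnormalised.Properties using (≃-refl)
open import Relation.Binary.PropositionalEquality using (_≡_; sym; subst; subst₂)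
open StirlingSums
open Fractions

B'≈T/2^ : ∀ n k → let instance _ = m^n≢0 2 k in B' n k ≈ T n k / 2 ^ k
B'≈T/2^ n zero    = ≃-refl
B'≈T/2^ n (suc k) = ≈-resp (≈-+ (B'≈T/2^ n k) (frac-≈ (S n (suc k)) (2 ^ suc k))) (regroup (T n k) (S n (suc k)) (2 ^ k))
  where
  instance
    _ = m^n≢0 2 k
    _ = m^n≢0 2 (suc k)
    _ = m*n≢0 (2 ^ k) (2 ^ suc k)
  regroup : ∀ t s P → (t ℕ.* (2 ℕ.* P) ℕ.+ s ℕ.* P) ℕ.* (2 ℕ.* P) ≡ (2 ℕ.* t ℕ.+ s) ℕ.* (P ℕ.* (2 ℕ.* P))
  regroup = solve-∀

a-<⇒ascent : ∀ n q → a (suc n) q < a (suc n) (suc q) → Ascent n q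
a-<⇒ascent n q aq<aq+1 = *-cancelʳ-< (suc q ℕ.* D) _ _ (subst₂ ℕ._<_ (lhs q (q ^ n) (q !) (2 ^ q)) (rhs q (suc q ^ n) (q !) (2 ^ q))
  (≈-<⁻ (frac-≈ (q ^ suc n) D) (frac-≈ (suc q ^ suc n) (suc q ! ℕ.* 2 ^ suc q)) aq<aq+1))
  where
  D = q ! ℕ.* 2 ^ q
  instance
    _ = m*n≢0 (q !) (2 ^ q) {{q !≢0}} {{m^n≢0 2 q}}
    _ = m*n≢0 (suc q !) (2 ^ suc q) {{suc q !≢0}} {{m^n≢0 2 (suc q)}}
  lhs : ∀ q Q F P → q ℕ.* Q ℕ.* (suc q ℕ.* F ℕ.* (2 ℕ.* P)) ≡ 2 ℕ.* q ℕ.* Q ℕ.* (suc q ℕ.* (F ℕ.* P))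
  lhs = solve-∀
  rhs : ∀ q Q F P → suc q ℕ.* Q ℕ.* (F ℕ.* P) ≡ Q ℕ.* (suc q ℕ.* (F ℕ.* P))
  rhs = solve-∀

ratio-bounds : ∀ n {z : ℤ} {m} → IsM (suc (suc n)) m → + 2 Data.Integer.≤ z → z Data.Integer.≤ + m →
    (frac (+ 1) 2 * divℚ 1ℚ (ℤtoℚ z) ≤ divℚ (B (suc n) z) (B (suc (suc n)) z))
  × (divℚ (B (suc n) z) (B (suc (suc n)) z) ≤ frac (+ 9) 1 * divℚ 1ℚ (ℤtoℚ z))
ratio-bounds n {m = m} (_ , m≤n+2 , increasing , _) (+≤+ 2≤K@(s≤s (s≤s (z≤n {K′})))) (+≤+ K≤m) =
  ≈-≤ (≈-* (frac-≈ 1 2) 1/K≈) ratio≈ lower , ≈-≤ ratio≈ (≈-* (frac-≈ 9 1) 1/K≈) upper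
  where
  K = suc (suc K′)
  instance
    _ = m^n≢0 2 K
    _ = >-nonZero (T-pos (suc n) (suc K′))
  ratio≈ : divℚ (B' (suc n) K) (B' (suc (suc n)) K) ≈ T (suc n) K / T (suc (suc n)) K
  ratio≈ = ≈-divℚ (B'≈T/2^ (suc n) K) (B'≈T/2^ (suc (suc n)) K)
  1/K≈ : divℚ 1ℚ (ℤtoℚ (+ K)) ≈ 1 / K
  1/K≈ = ≈-divℚ ≃-refl (frac-≈ K 1)
  ascending : Ascending (suc n) m
  ascending q 1≤q q<m = a-<⇒ascent (suc n) q (increasing q 1≤q q<m)
  lower : 1 ℕ.* T (suc (suc n)) K ℕ.≤ T (suc n) K ℕ.* (2 ℕ.* K)
  lower = subst (ℕ._≤ T (suc n) K ℕ.* (2 ℕ.* K)) (sym (*-identityˡ _)) (T-ratio-lower n (suc K′))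
  upper : T (suc n) K ℕ.* (1 ℕ.* K) ℕ.≤ 9 ℕ.* T (suc (suc n)) K
  upper = subst (ℕ._≤ 9 ℕ.* T (suc (suc n)) K) (flip K (T (suc n) K)) (T-ratio-upper ascending m≤n+2 2≤K K≤m)
    where
    flip : ∀ k t → k ℕ.* t ≡ t ℕ.* (1 ℕ.* k)
    flip = solve-∀

lemma3 : (k : ℕ → ℤ)
    → (∀ (K : ℤ) → ∃ λ N → ∀ n → n ≥ N → K Data.Integer.≤ k n)
    → (∃ λ N → ∀ n → n ≥ N → ∃ λ m → IsM n m × (k n Data.Integer.≤ + m))
    → Σ ℚ λ c → Σ ℚ λ C → (0ℚ < c) × (0ℚ < C) × (∃ λ N → ∀ n → n ≥ N →
    (c * divℚ 1ℚ (ℤtoℚ (k (suc n))) ≤ divℚ (B n (k (suc n))) (B (suc n) (k (suc n))))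
    × (divℚ (B n (k (suc n))) (B (suc n) (k (suc n))) ≤ C * divℚ 1ℚ (ℤtoℚ (k (suc n)))))
lemma3 k k→∞ k≤M with k→∞ (+ 2) | k≤M
... | N₁ , k≥2 | N₂ , k≤Mₙ =
  frac (+ 1) 2 , frac (+ 9) 1 , ≈-< ≃-refl (frac-≈ 1 2) (s≤s z≤n) , ≈-< ≃-refl (frac-≈ 9 1) (s≤s z≤n) ,
  suc (N₁ ⊔ N₂) , λ where
    (suc n) (s≤s N≤n) →
      let N≤n+2 = ≤-trans N≤n (m≤n+m n 2)
          m , isM , k≤m = k≤Mₙ (suc (suc n)) (≤-trans (m≤n⊔m N₁ N₂) N≤n+2)
      in ratio-bounds n isM (k≥2 (suc (suc n)) (≤-trans (m≤m⊔n N₁ N₂) N≤n+2)) k≤m
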